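{- SBSR properly contains SF and, hence, BSR and MFO.
   Context: Tuples of variables are identified with sets; $\mathrm{vars}(A)$ is the set of variables in $A$; disjoint sets $X,Y$ of variables are separated in $\varphi$ if every atom $A$ in $\varphi$ satisfies $\mathrm{vars}(A)\cap X=\emptyset$ or $\mathrm{vars}(A)\cap Y=\emptyset$. MFO (monadic first-order fragment) comprises all relational first-order sentences without equality containing only unary predicate symbols; containment of MFO in a fragment of prenex sentences is understood as: every MFO sentence in prenex normal form belongs to the fragment (every MFO sentence is equivalent to such a prenex one). BSR comprises all relational prenex sentences with equality with quantifier prefix $\exists^*\forall^*$. SF (separated fragment) comprises all relational sentences with equality of the form $\exists\mathbf{z}\,\forall\mathbf{x}_1\exists\mathbf{y}_1\ldots\forall\mathbf{x}_n\exists\mathbf{y}_n.\,\psi$ with quantifier-free $\psi$ in which $\mathbf{x}_1\cup\ldots\cup\mathbf{x}_n$ and $\mathbf{y}_1\cup\ldots\cup\mathbf{y}_n$ are separated ($\mathbf{z}$ and $\mathbf{y}_n$ may be empty). SBSR: let $Y, X_1, X_2, \ldots$ be pairwise disjoint countable sets of variables; SBSR comprises all relational sentences with equality of the shape $\forall\mathbf{x}_1\exists\mathbf{y}_1\ldots\forall\mathbf{x}_n\exists\mathbf{y}_n.\,\psi$ with quantifier-free $\psi$ (tuples may be empty; no variable quantified twice) such that (a) $\mathbf{x}_i\subseteq X_1\cup\ldots\cup X_i$ and $\mathbf{y}_i\subseteq Y$ for all $i$, and (b) every atom $A$ satisfies $\mathrm{vars}(A)\subseteq\mathbf{y}_1\cup\ldots\cup\mathbf{y}_i\cup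 X_{i+1}$ for some $i$ with $0\le i\le n$. "Properly contains" means containment together with the existence of sentences in the larger class not belonging to the smaller one. -}

module Defs where

open import Data.Nat using (ℕ; _≤_; _<_)
open import Data.List using (List; []; _∷_; _++_; map; concat; concatMap; length)
open import Data.List.Membership.Propositional using (_∈_; _∉_)
open import Data.List.Relation.Unary.Unique.Propositional using (Unique)
open import Data.Vec using (Vec; toList)
import Data.Vec as Vec
open import Data.Product using (Σ; ∃; ∃-syntax; _×_; _,_; proj₁; proj₂)
open import Data.Sum using (_⊎_)
open import Relation.Binary.PropositionalEquality using (_≡_)
open import Relation.Nullary using (¬_)
open import Data.Empty using (⊥)
open import Data.Unit using (⊤)
open import Function.Definitions using (Injective)

-- The set of all variables is the disjoint union of
--   Y = { yv k | k : ℕ }   and   X_(i+1) = { xv i k | k : ℕ }  (i : ℕ),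
-- i.e. the pairwise disjoint countably infinite sets Y, X₁, X₂, ...
-- used in the definition of SBSR.  (xv i k lies in X_(i+1).)

data Var : Set where
  yv : ℕ → Var
  xv : ℕ → ℕ → Var

InY : Var → Set
InY v = ∃[ k ] (v ≡ yv k)

InX : ℕ → Var → Set           -- InX i v  :  v ∈ X_(i+1)
InX i v = ∃[ k ] (v ≡ xv i k)

data Atom : Set where
  pred : (p : ℕ) (n : ℕ) → Vec Var n → Atom
  eq   : Var → Var → Atom

vars : Atom → List Var
vars (pred p n ts) = toList ts
vars (eq u v)      = u ∷ v ∷ []

data QF : Set where
  atom    : Atom → QF
  ⊤f ⊥f   : QF
  ¬f_     : QF → QF
  _∧f_ _∨f_ _⇒f_ _⇔f_ : QF → QF → QF

atoms : QF → List Atom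
atoms (atom a)  = a ∷ []
atoms ⊤f        = []
atoms ⊥f        = []
atoms (¬f φ)    = atoms φ
atoms (φ ∧f ψ)  = atoms φ ++ atoms ψ
atoms (φ ∨f ψ)  = atoms φ ++ atoms ψ
atoms (φ ⇒f ψ)  = atoms φ ++ atoms ψ
atoms (φ ⇔f ψ)  = atoms φ ++ atoms ψ

data Q : Set where
  ∀q ∃q : Q

record Prenex : Set where
  constructor ⟨_∣_⟩
  field
    prefix : List (Q × Var)
    matrix : QF
open Prenex public

boundVars : Prenex → List Var
boundVars φ = map proj₂ (prefix φ)

IsSentence : Prenex → Set
IsSentence φ =
  Unique (boundVars φ) ×
  (∀ {A v} → A ∈ atoms (matrix φ) → v ∈ vars A → v ∈ boundVars φ)

∀* ∃* : List Var → List (Q × Var)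
∀* = map (λ v → ∀q , v)
∃* = map (λ v → ∃q , v)

alternation : List (List Var × List Var) → List (Q × Var)
alternation []              = []
alternation ((x , y) ∷ bs)  = ∀* x ++ ∃* y ++ alternation bs

allX allY : List (List Var × List Var) → List Var
allX bs = concatMap proj₁ bs
allY bs = concatMap proj₂ bs

Separated : List Var → List Var → QF → Set
Separated X Y φ = ∀ {A} → A ∈ atoms φ →
  (∀ {v} → v ∈ vars A → v ∉ X) ⊎ (∀ {v} → v ∈ vars A → v ∉ Y)

Disjoint : List Var → List Var → Set
Disjoint X Y = ∀ {v} → v ∈ X → v ∉ Y

IsMonadic : Atom → Set
IsMonadic (pred p n ts) = n ≡ 1
IsMonadic (eq u v)      = ⊥

MFO : Prenex → Set
MFO φ = IsSentence φ × (∀ {A} → A ∈ atoms (matrix φ) → IsMonadic A)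

BSR : Prenex → Set
BSR φ = IsSentence φ ×
  ∃[ z ] ∃[ x ] (prefix φ ≡ ∃* z ++ ∀* x)

SF : Prenex → Set
SF φ = IsSentence φ ×
  ∃[ z ] ∃[ bs ] ((prefix φ ≡ ∃* z ++ alternation bs) ×
                  Disjoint (allX bs) (allY bs) ×
                  Separated (allX bs) (allY bs) (matrix φ))

takeB : ℕ → List (List Var × List Var) → List (List Var × List Var)
takeB _       []       = []
takeB ℕ.zero  (b ∷ bs) = []
takeB (ℕ.suc i) (b ∷ bs) = b ∷ takeB i bs

-- condition (a): for the block at 0-based position p (i.e. i = p+1),
-- x_i ⊆ X₁ ∪ … ∪ X_i  and  y_i ⊆ Y
CondA : ℕ → List (List Var × List Var) → Set
CondA p []              = ⊤
CondA p ((x , y) ∷ bs)  =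
  (∀ {v} → v ∈ x → ∃[ j ] (j ≤ p × InX j v)) ×
  (∀ {v} → v ∈ y → InY v) ×
  CondA (ℕ.suc p) bs

CondB : List (List Var × List Var) → QF → Set
CondB bs ψ = ∀ {A} → A ∈ atoms ψ →
  ∃[ i ] (i ≤ length bs ×
          (∀ {v} → v ∈ vars A → v ∈ allY (takeB i bs) ⊎ InX i v))

SBSR : Prenex → Set
SBSR φ = IsSentence φ ×
  ∃[ bs ] ((prefix φ ≡ alternation bs) × CondA 0 bs × CondB bs (matrix φ))

renA : (Var → Var) → Atom → Atom
renA ρ (pred p n ts) = pred p n (Vec.map ρ ts)
renA ρ (eq u v)      = eq (ρ u) (ρ v)

renQF : (Var → Var) → QF → QF
renQF ρ (atom a)  = atom (renA ρ a)
renQF ρ ⊤f        = ⊤f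
renQF ρ ⊥f        = ⊥f
renQF ρ (¬f φ)    = ¬f renQF ρ φ
renQF ρ (φ ∧f ψ)  = renQF ρ φ ∧f renQF ρ ψ
renQF ρ (φ ∨f ψ)  = renQF ρ φ ∨f renQF ρ ψ
renQF ρ (φ ⇒f ψ)  = renQF ρ φ ⇒f renQF ρ ψ
renQF ρ (φ ⇔f ψ)  = renQF ρ φ ⇔f renQF ρ ψ

rename : (Var → Var) → Prenex → Prenex
rename ρ φ = ⟨ map (λ qv → proj₁ qv , ρ (proj₂ qv)) (prefix φ) ∣ renQF ρ (matrix φ) ⟩

-- F ⊑ G : every sentence of F belongs to G, up to an injective renaming
-- of its (bound) variables (i.e. up to α-equivalence).
_⊑_ : (Prenex → Set) → (Prenex → Set) → Set
F ⊑ G = ∀ φ → F φ → ∃[ ρ ] (Injective _≡_ _≡_ ρ × G (rename ρ φ))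

_⊏_ : (Prenex → Set) → (Prenex → Set) → Set
F ⊏ G = (F ⊑ G) × ∃[ φ ] (G φ × ¬ F φ)

module Submission where

-- Read the prefix ∃z ∀x₁∃y₁…∀xₙ∃yₙ of an SF sentence as ∀∅∃z ∀x₁∃y₁…∀xₙ∃yₙ and rename
-- every universal variable into X₂ and every existential one into Y; condition (a) is then
-- immediate.  By separation an atom either has no universal variable, so its variables lie
-- in z ∪ y₁ ∪ … ∪ yₙ (take i = n + 1), or has no yⱼ, so they lie in z ∪ X₂ (take i = 1).
-- BSR sentences are SF with a single block, and prenex MFO sentences are SF with one block
-- per quantifier since a monadic atom is trivially separated.  ∀x₁∃y∀x₂. R(y, x₂) is SBSR
-- (with i = 1) but not SF, because R(y, x₂) mixes y with a universal variable quantified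
-- after it; it is neither BSR nor MFO.

open import Defs
open import Data.Nat using (ℕ; suc; _≤_; z≤n; s≤s)
import Data.Nat as ℕ
open import Data.Nat.Properties using (≤-refl)
open import Data.Fin using (toℕ)
open import Data.Fin.Properties using (toℕ-injective)
open import Data.List using (List; []; _∷_; _++_; map; concatMap; length; lookup)
open import Data.List.Properties using (map-++; map-∘; ++-identityʳ)
open import Data.List.Membership.Propositional using (_∈_; _∉_)
open import Data.List.Membership.Propositional.Properties using (∈-map⁺; ∈-map⁻; ∈-++⁺ˡ; ∈-++⁺ʳ; ∈-++⁻)
open import Data.List.Relation.Unary.Any using (here; there; index)
open import Data.List.Relation.Unary.Any.Properties using (lookup-index)
import Data.List.Relation.Unary.All as All
open import Data.List.Relation.Unary.AllPairs using ([]; _∷_)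
open import Data.List.Relation.Unary.Unique.Propositional using (Unique)
import Data.List.Relation.Unary.Unique.Propositional.Properties as Unique
import Data.Vec as Vec
open import Data.Vec.Properties using (toList-map)
open import Data.Product using (_×_; _,_; proj₁; proj₂; ∃-syntax; map₂)
import Data.Product as Product
open import Data.Sum using (_⊎_; inj₁; inj₂)
open import Data.Empty using (⊥-elim)
open import Data.Unit using (tt)
open import Function using (_∘_)
open import Function.Definitions using (Injective)
open import Relation.Nullary using (¬_; Dec; yes; no)
open import Relation.Binary.Definitions using (DecidableEquality)
open import Relation.Binary.PropositionalEquality using (_≡_; refl; sym; trans; cong; cong₂; subst; module ≡-Reasoning)

_≟ᵥ_ : DecidableEquality Var
yv k ≟ᵥ yv l with k ℕ.≟ l
... | yes refl = yes refl
... | no k≢l   = no λ { refl → k≢l refl }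
yv _ ≟ᵥ xv _ _ = no λ ()
xv _ _ ≟ᵥ yv _ = no λ ()
xv i k ≟ᵥ xv j l with i ℕ.≟ j | k ℕ.≟ l
... | yes refl | yes refl = yes refl
... | no i≢j   | _        = no λ { refl → i≢j refl }
... | _        | no k≢l   = no λ { refl → k≢l refl }

open import Data.List.Membership.DecPropositional _≟ᵥ_ using (_∈?_)

index-injective : ∀ {A : Set} {xs : List A} {x y} (p : x ∈ xs) (q : y ∈ xs) → index p ≡ index q → x ≡ y
index-injective {xs = xs} p q p≡q = trans (lookup-index p) (trans (cong (lookup xs) p≡q) (sym (lookup-index q)))

unique-map⇒injectiveOn : ∀ {A B : Set} {f : A → B} {xs x y} → Unique (map f xs) →
                         x ∈ xs → y ∈ xs → f x ≡ f y → x ≡ y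
unique-map⇒injectiveOn _            (here refl) (here refl) _   = refl
unique-map⇒injectiveOn (fx∉ ∷ _)    (here refl) (there y∈) fx≡fy = ⊥-elim (All.lookup fx∉ (∈-map⁺ _ y∈) fx≡fy)
unique-map⇒injectiveOn (fy∉ ∷ _)    (there x∈) (here refl) fx≡fy = ⊥-elim (All.lookup fy∉ (∈-map⁺ _ x∈) (sym fx≡fy))
unique-map⇒injectiveOn (_ ∷ unique) (there x∈) (there y∈) fx≡fy = unique-map⇒injectiveOn unique x∈ y∈ fx≡fy

subscript : Var → ℕ
subscript (yv k)   = k
subscript (xv _ k) = k

-- Injective, sending X into X₂ and Y ∖ X into Y; variables outside X ∪ Y are moved to
-- X₁ ∪ X₃ ∪ X₄ ∪ … only to keep the renaming total and injective.
module SeparatingRenaming (X Y : List Var) where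

  outside : Var → Var
  outside (yv k)   = xv 0 k
  outside (xv i k) = xv (2 ℕ.+ i) k

  outside-injective : Injective _≡_ _≡_ outside
  outside-injective {yv _}   {yv _}   refl = refl
  outside-injective {xv _ _} {xv _ _} refl = refl

  outside-∉X₂ : ∀ v → ¬ InX 1 (outside v)
  outside-∉X₂ (yv _)   (_ , ())
  outside-∉X₂ (xv _ _) (_ , ())

  outside-∉Y : ∀ v → ¬ InY (outside v)
  outside-∉Y (yv _)   (_ , ())
  outside-∉Y (xv _ _) (_ , ())

  place : (v : Var) → Dec (v ∈ X) → Dec (v ∈ Y) → Var
  place v (yes v∈X) _         = xv 1 (toℕ (index v∈X))
  place v (no _)    (yes v∈Y) = yv (toℕ (index v∈Y))
  place v (no _)    (no _)    = outside v

  ρ : Var → Var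
  ρ v = place v (v ∈? X) (v ∈? Y)

  place-injective : ∀ {v w} dX dY eX eY → place v dX dY ≡ place w eX eY → v ≡ w
  place-injective (yes p) _ (yes q) _ ρv≡ρw = index-injective p q (toℕ-injective (cong subscript ρv≡ρw))
  place-injective (yes _) _ (no _) (yes _) ()
  place-injective {w = w} (yes _) _ (no _) (no _) ρv≡ρw = ⊥-elim (outside-∉X₂ w (_ , sym ρv≡ρw))
  place-injective (no _) (yes _) (yes _) _ ()
  place-injective (no _) (yes p) (no _) (yes q) ρv≡ρw = index-injective p q (toℕ-injective (cong subscript ρv≡ρw))
  place-injective {w = w} (no _) (yes _) (no _) (no _) ρv≡ρw = ⊥-elim (outside-∉Y w (_ , sym ρv≡ρw))
  place-injective {v} (no _) (no _) (yes _) _ ρv≡ρw = ⊥-elim (outside-∉X₂ v (_ , ρv≡ρw))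
  place-injective {v} (no _) (no _) (no _) (yes _) ρv≡ρw = ⊥-elim (outside-∉Y v (_ , ρv≡ρw))
  place-injective (no _) (no _) (no _) (no _) ρv≡ρw = outside-injective ρv≡ρw

  ρ-injective : Injective _≡_ _≡_ ρ
  ρ-injective {v} {w} = place-injective (v ∈? X) (v ∈? Y) (w ∈? X) (w ∈? Y)

  ρ-X₂ : ∀ {v} → v ∈ X → InX 1 (ρ v)
  ρ-X₂ {v} v∈X with v ∈? X
  ... | yes _   = _ , refl
  ... | no v∉X  = ⊥-elim (v∉X v∈X)

  ρ-Y : ∀ {v} → v ∉ X → v ∈ Y → InY (ρ v)
  ρ-Y {v} v∉X v∈Y with v ∈? X | v ∈? Y
  ... | yes v∈X | _       = ⊥-elim (v∉X v∈X)
  ... | no _    | yes _   = _ , refl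
  ... | no _    | no v∉Y  = ⊥-elim (v∉Y v∈Y)

renameBlocks : (Var → Var) → List (List Var × List Var) → List (List Var × List Var)
renameBlocks ρ = map (Product.map (map ρ) (map ρ))

module _ (ρ : Var → Var) where

  map-alternation : ∀ bs → map (map₂ ρ) (alternation bs) ≡ alternation (renameBlocks ρ bs)
  map-alternation [] = refl
  map-alternation ((x , y) ∷ bs) = begin
    map (map₂ ρ) (∀* x ++ ∃* y ++ alternation bs)
      ≡⟨ map-++ _ (∀* x) _ ⟩
    map (map₂ ρ) (∀* x) ++ map (map₂ ρ) (∃* y ++ alternation bs)
      ≡⟨ cong (map (map₂ ρ) (∀* x) ++_) (map-++ _ (∃* y) _) ⟩
    map (map₂ ρ) (∀* x) ++ map (map₂ ρ) (∃* y) ++ map (map₂ ρ) (alternation bs)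
      ≡⟨ cong₂ _++_ (map-∘-swap x) (cong₂ _++_ (map-∘-swap y) (map-alternation bs)) ⟩
    ∀* (map ρ x) ++ ∃* (map ρ y) ++ alternation (renameBlocks ρ bs)
      ∎
    where
    open ≡-Reasoning
    map-∘-swap : ∀ {q} (vs : List Var) → map (map₂ ρ) (map (q ,_) vs) ≡ map (q ,_) (map ρ vs)
    map-∘-swap vs = trans (sym (map-∘ vs)) (map-∘ vs)

  allX-renameBlocks : ∀ bs → allX (renameBlocks ρ bs) ≡ map ρ (allX bs)
  allX-renameBlocks [] = refl
  allX-renameBlocks ((x , _) ∷ bs) = trans (cong (map ρ x ++_) (allX-renameBlocks bs)) (sym (map-++ ρ x _))

  allY-renameBlocks : ∀ bs → allY (renameBlocks ρ bs) ≡ map ρ (allY bs)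
  allY-renameBlocks [] = refl
  allY-renameBlocks ((_ , y) ∷ bs) = trans (cong (map ρ y ++_) (allY-renameBlocks bs)) (sym (map-++ ρ y _))

  atoms-renQF : ∀ ψ → atoms (renQF ρ ψ) ≡ map (renA ρ) (atoms ψ)
  atoms-renQF-++ : ∀ φ ψ → atoms (renQF ρ φ) ++ atoms (renQF ρ ψ) ≡ map (renA ρ) (atoms φ ++ atoms ψ)

  atoms-renQF (atom _) = refl
  atoms-renQF ⊤f       = refl
  atoms-renQF ⊥f       = refl
  atoms-renQF (¬f ψ)   = atoms-renQF ψ
  atoms-renQF (φ ∧f ψ) = atoms-renQF-++ φ ψ
  atoms-renQF (φ ∨f ψ) = atoms-renQF-++ φ ψ
  atoms-renQF (φ ⇒f ψ) = atoms-renQF-++ φ ψ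
  atoms-renQF (φ ⇔f ψ) = atoms-renQF-++ φ ψ

  atoms-renQF-++ φ ψ = trans (cong₂ _++_ (atoms-renQF φ) (atoms-renQF ψ)) (sym (map-++ _ (atoms φ) _))

  vars-renA : ∀ A → vars (renA ρ A) ≡ map ρ (vars A)
  vars-renA (pred _ _ ts) = toList-map ρ ts
  vars-renA (eq _ _)      = refl

  ∈-atoms-renQF⁻ : ∀ ψ {B} → B ∈ atoms (renQF ρ ψ) → ∃[ A ] (A ∈ atoms ψ × B ≡ renA ρ A)
  ∈-atoms-renQF⁻ ψ B∈ = ∈-map⁻ (renA ρ) (subst (_ ∈_) (atoms-renQF ψ) B∈)

  all-vars-renA : ∀ {P : Var → Set} A → (∀ {v} → v ∈ vars A → P (ρ v)) → ∀ {w} → w ∈ vars (renA ρ A) → P w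
  all-vars-renA A h w∈ with ∈-map⁻ ρ (subst (_ ∈_) (vars-renA A) w∈)
  ... | _ , v∈ , refl = h v∈

  boundVars-rename : ∀ φ → boundVars (rename ρ φ) ≡ map ρ (boundVars φ)
  boundVars-rename φ = trans (sym (map-∘ (prefix φ))) (map-∘ (prefix φ))

  rename-sentence : Injective _≡_ _≡_ ρ → ∀ φ → IsSentence φ → IsSentence (rename ρ φ)
  rename-sentence ρ-inj φ (unique , closed) =
    subst Unique (sym (boundVars-rename φ)) (Unique.map⁺ ρ-inj unique) , closed′
    where
    closed′ : ∀ {B w} → B ∈ atoms (renQF ρ (matrix φ)) → w ∈ vars B → w ∈ boundVars (rename ρ φ)
    closed′ B∈ with ∈-atoms-renQF⁻ (matrix φ) B∈
    ... | A , A∈ , refl = all-vars-renA A λ v∈ → subst (_ ∈_) (sym (boundVars-rename φ)) (∈-map⁺ ρ (closed A∈ v∈))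

block : Q → List Var × List Var → List Var
block ∀q = proj₁
block ∃q = proj₂

quantified : Q → List (List Var × List Var) → List Var
quantified q = concatMap (block q)

∈-alternation⁺ : ∀ q bs {v} → v ∈ quantified q bs → (q , v) ∈ alternation bs
∈-alternation⁺ ∀q ((x , y) ∷ bs) v∈ with ∈-++⁻ x v∈
... | inj₁ v∈x = ∈-++⁺ˡ (∈-map⁺ _ v∈x)
... | inj₂ v∈bs = ∈-++⁺ʳ (∀* x) (∈-++⁺ʳ (∃* y) (∈-alternation⁺ ∀q bs v∈bs))
∈-alternation⁺ ∃q ((x , y) ∷ bs) v∈ with ∈-++⁻ y v∈
... | inj₁ v∈y = ∈-++⁺ʳ (∀* x) (∈-++⁺ˡ (∈-map⁺ _ v∈y))
... | inj₂ v∈bs = ∈-++⁺ʳ (∀* x) (∈-++⁺ʳ (∃* y) (∈-alternation⁺ ∃q bs v∈bs))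

∈-alternation⁻ : ∀ bs {q v} → (q , v) ∈ alternation bs → v ∈ quantified q bs
∈-alternation⁻ ((x , y) ∷ bs) {q} qv∈ with ∈-++⁻ (∀* x) qv∈
... | inj₁ qv∈x with ∈-map⁻ _ qv∈x
...   | _ , v∈x , refl = ∈-++⁺ˡ v∈x
∈-alternation⁻ ((x , y) ∷ bs) {q} qv∈ | inj₂ qv∈rest with ∈-++⁻ (∃* y) qv∈rest
... | inj₁ qv∈y with ∈-map⁻ _ qv∈y
...   | _ , v∈y , refl = ∈-++⁺ˡ v∈y
∈-alternation⁻ ((x , y) ∷ bs) {q} qv∈ | inj₂ _ | inj₂ qv∈bs = ∈-++⁺ʳ (block q (x , y)) (∈-alternation⁻ bs qv∈bs)

∈-boundVars-alternation⁻ : ∀ bs {v} → v ∈ map proj₂ (alternation bs) → v ∈ allX bs ⊎ v ∈ allY bs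
∈-boundVars-alternation⁻ bs v∈ with ∈-map⁻ proj₂ v∈
... | (∀q , _) , qv∈ , refl = inj₁ (∈-alternation⁻ bs qv∈)
... | (∃q , _) , qv∈ , refl = inj₂ (∈-alternation⁻ bs qv∈)

unique-alternation⇒disjoint : ∀ bs → Unique (map proj₂ (alternation bs)) → Disjoint (allX bs) (allY bs)
unique-alternation⇒disjoint bs unique v∈X v∈Y
  with unique-map⇒injectiveOn unique (∈-alternation⁺ ∀q bs v∈X) (∈-alternation⁺ ∃q bs v∈Y) refl
... | ()

CondA-X₂Y : ∀ p bs → (∀ {v} → v ∈ allX bs → InX 1 v) → (∀ {v} → v ∈ allY bs → InY v) → CondA (suc p) bs
CondA-X₂Y p [] _ _ = tt
CondA-X₂Y p ((x , y) ∷ bs) X₂ Y =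
  (λ v∈x → 1 , s≤s z≤n , X₂ (∈-++⁺ˡ v∈x)) ,
  (λ v∈y → Y (∈-++⁺ˡ v∈y)) ,
  CondA-X₂Y (suc p) bs (X₂ ∘ ∈-++⁺ʳ x) (Y ∘ ∈-++⁺ʳ y)

takeB-length : ∀ bs → takeB (length bs) bs ≡ bs
takeB-length []       = refl
takeB-length (b ∷ bs) = cong (b ∷_) (takeB-length bs)

module _ (ρ : Var → Var) (z : List Var) (bs : List (List Var × List Var)) where

  private
    blocks : List (List Var × List Var)
    blocks = ([] , z) ∷ bs

    renamed : List (List Var × List Var)
    renamed = renameBlocks ρ blocks

    Placed : ℕ → Var → Set
    Placed i w = w ∈ allY (takeB i renamed) ⊎ InX i w

  renamed-CondA : (∀ {v} → v ∈ allX bs → InX 1 (ρ v)) → (∀ {v} → v ∈ allY blocks → InY (ρ v)) →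
                  CondA 0 renamed
  renamed-CondA ρ-X₂ ρ-Y = (λ ()) , Y ∘ ∈-++⁺ˡ , CondA-X₂Y 0 (renameBlocks ρ bs) X₂ (Y ∘ ∈-++⁺ʳ (map ρ z))
    where
    X₂ : ∀ {w} → w ∈ allX renamed → InX 1 w
    X₂ w∈ with ∈-map⁻ ρ (subst (_ ∈_) (allX-renameBlocks ρ bs) w∈)
    ... | _ , v∈ , refl = ρ-X₂ v∈

    Y : ∀ {w} → w ∈ allY renamed → InY w
    Y w∈ with ∈-map⁻ ρ (subst (_ ∈_) (allY-renameBlocks ρ blocks) w∈)
    ... | _ , v∈ , refl = ρ-Y v∈

  renamed-CondB : ∀ ψ → (∀ {v} → v ∈ allX bs → InX 1 (ρ v)) →
                  (∀ {A v} → A ∈ atoms ψ → v ∈ vars A → v ∈ allX bs ⊎ v ∈ allY blocks) →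
                  Separated (allX bs) (allY bs) ψ → CondB renamed (renQF ρ ψ)
  renamed-CondB ψ ρ-X₂ bound separated B∈ with ∈-atoms-renQF⁻ ρ ψ B∈
  ... | A , A∈ , refl with separated A∈
  ... | inj₁ noX = length renamed , ≤-refl , all-vars-renA ρ {Placed (length renamed)} A (inj₁ ∘ inAllY)
    where
    inAllY : ∀ {v} → v ∈ vars A → ρ v ∈ allY (takeB (length renamed) renamed)
    inAllY {v} v∈ with bound A∈ v∈
    ... | inj₁ v∈X = ⊥-elim (noX v∈ v∈X)
    ... | inj₂ v∈Y = subst (λ cs → ρ v ∈ allY cs) (sym (takeB-length renamed))
                           (subst (ρ v ∈_) (sym (allY-renameBlocks ρ blocks)) (∈-map⁺ ρ v∈Y))
  ... | inj₂ noY = 1 , s≤s z≤n , all-vars-renA ρ {Placed 1} A inFirstBlock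
    where
    inFirstBlock : ∀ {v} → v ∈ vars A → Placed 1 (ρ v)
    inFirstBlock v∈ with bound A∈ v∈
    ... | inj₁ v∈X = inj₂ (ρ-X₂ v∈X)
    ... | inj₂ v∈Y with ∈-++⁻ z v∈Y
    ...   | inj₁ v∈z = inj₁ (∈-++⁺ˡ (∈-map⁺ ρ v∈z))
    ...   | inj₂ v∈Yᵇˢ = ⊥-elim (noY v∈ v∈Yᵇˢ)

separated⇒SBSR : ∀ z bs φ → IsSentence φ → prefix φ ≡ alternation (([] , z) ∷ bs) →
                 Separated (allX bs) (allY bs) (matrix φ) →
                 ∃[ ρ ] (Injective _≡_ _≡_ ρ × SBSR (rename ρ φ))
separated⇒SBSR z bs ⟨ _ ∣ ψ ⟩ sentence@(unique , closed) refl separated =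
  ρ , ρ-injective , rename-sentence ρ ρ-injective ⟨ alternation blocks ∣ ψ ⟩ sentence ,
  renameBlocks ρ blocks , map-alternation ρ blocks ,
  renamed-CondA ρ z bs ρ-X₂ (λ v∈Y → ρ-Y (λ v∈X → disjoint v∈X v∈Y) v∈Y) ,
  renamed-CondB ρ z bs ψ ρ-X₂ (λ A∈ v∈ → ∈-boundVars-alternation⁻ blocks (closed A∈ v∈)) separated
  where
  blocks : List (List Var × List Var)
  blocks = ([] , z) ∷ bs

  open SeparatingRenaming (allX bs) (allY blocks)

  disjoint : Disjoint (allX bs) (allY blocks)
  disjoint = unique-alternation⇒disjoint blocks unique

SF⊑SBSR : SF ⊑ SBSR
SF⊑SBSR φ (sentence , z , bs , prefix≡ , _ , separated) = separated⇒SBSR z bs φ sentence prefix≡ separated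

BSR⊑SBSR : BSR ⊑ SBSR
BSR⊑SBSR φ (sentence , z , x , prefix≡) =
  separated⇒SBSR z ((x , []) ∷ []) φ sentence
    (trans prefix≡ (cong (∃* z ++_) (sym (++-identityʳ (∀* x)))))
    (λ _ → inj₂ λ _ ())

singletonBlocks : List (Q × Var) → List (List Var × List Var)
singletonBlocks []             = []
singletonBlocks ((∀q , v) ∷ p) = (v ∷ [] , []) ∷ singletonBlocks p
singletonBlocks ((∃q , v) ∷ p) = ([] , v ∷ []) ∷ singletonBlocks p

alternation-singletonBlocks : ∀ p → alternation (singletonBlocks p) ≡ p
alternation-singletonBlocks []             = refl
alternation-singletonBlocks ((∀q , _) ∷ p) = cong (_ ∷_) (alternation-singletonBlocks p)
alternation-singletonBlocks ((∃q , _) ∷ p) = cong (_ ∷_) (alternation-singletonBlocks p)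

monadic-separated : ∀ {X Y} → Disjoint X Y → ∀ {A} → IsMonadic A →
                    (∀ {v} → v ∈ vars A → v ∉ X) ⊎ (∀ {v} → v ∈ vars A → v ∉ Y)
monadic-separated {X} disjoint {pred _ _ (t Vec.∷ Vec.[])} refl with t ∈? X
... | yes t∈X = inj₂ λ { (here refl) → disjoint t∈X }
... | no t∉X  = inj₁ λ { (here refl) → t∉X }

MFO⊑SBSR : MFO ⊑ SBSR
MFO⊑SBSR φ (sentence@(unique , _) , monadic) =
  separated⇒SBSR [] bs φ sentence (sym (alternation-singletonBlocks (prefix φ)))
    (monadic-separated (unique-alternation⇒disjoint bs unique′) ∘ monadic)
  where
  bs : List (List Var × List Var)
  bs = singletonBlocks (prefix φ)

  unique′ : Unique (map proj₂ (alternation bs))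
  unique′ = subst (Unique ∘ map proj₂) (sym (alternation-singletonBlocks (prefix φ))) unique

x₁ y₁ x₂ : Var
x₁ = xv 0 0
y₁ = yv 0
x₂ = xv 1 0

separator : Prenex
separator = ⟨ (∀q , x₁) ∷ (∃q , y₁) ∷ (∀q , x₂) ∷ [] ∣ atom (pred 0 2 (y₁ Vec.∷ x₂ Vec.∷ Vec.[])) ⟩

separator-sentence : IsSentence separator
separator-sentence =
  ((λ ()) All.∷ (λ ()) All.∷ All.[]) ∷ ((λ ()) All.∷ All.[]) ∷ All.[] ∷ [] ,
  λ { (here refl) (here refl) → there (here refl) ; (here refl) (there (here refl)) → there (there (here refl)) }

separator-blocks : List (List Var × List Var)
separator-blocks = (x₁ ∷ [] , y₁ ∷ []) ∷ (x₂ ∷ [] , []) ∷ []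

separator-CondA : CondA 0 separator-blocks
separator-CondA =
  (λ { (here refl) → 0 , z≤n , _ , refl }) , (λ { (here refl) → _ , refl }) ,
  (λ { (here refl) → 1 , s≤s z≤n , _ , refl }) , (λ ()) , tt

separator-CondB : CondB separator-blocks (matrix separator)
separator-CondB (here refl) = 1 , s≤s z≤n , λ { (here refl) → inj₁ (here refl) ; (there (here refl)) → inj₂ (_ , refl) }

separator-SBSR : SBSR separator
separator-SBSR = separator-sentence , separator-blocks , refl , separator-CondA , separator-CondB

-- The omitted shapes of z and x are ruled out by the coverage checker, since the prefix of
-- the separator starts with ∀ and has length 3.
separator-∉SF : ¬ SF separator
separator-∉SF (_ , [] , bs , prefix≡ , _ , separated) with separated (here refl)
... | inj₁ noX = noX (there (here refl)) (∈-alternation⁻ bs {∀q} (subst ((∀q , x₂) ∈_) prefix≡ (there (there (here refl)))))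
... | inj₂ noY = noY (here refl) (∈-alternation⁻ bs {∃q} (subst ((∃q , y₁) ∈_) prefix≡ (there (here refl))))

separator-∉BSR : ¬ BSR separator
separator-∉BSR (_ , []    , _ ∷ [] , ())
separator-∉BSR (_ , []    , _ ∷ _ ∷ _ , ())

separator-∉MFO : ¬ MFO separator
separator-∉MFO (_ , monadic) with monadic (here refl)
... | ()

mainTheorem19 : (SF ⊏ SBSR) × (BSR ⊏ SBSR) × (MFO ⊏ SBSR)
mainTheorem19 =
  (SF⊑SBSR  , separator , separator-SBSR , separator-∉SF) ,
  (BSR⊑SBSR , separator , separator-SBSR , separator-∉BSR) ,
  (MFO⊑SBSR , separator , separator-SBSR , separator-∉MFO)
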